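{- Let $\mathcal{L}$ be a family of subsets of $[4]$ that is closed under intersection, has rank $3$ and is of type 2. Then $\mathcal{L}$ contains a minimal $3$-cycle each of whose edges has size $2$ or $3$, i.e. there are three distinct members $A_1,A_2,A_3\in\mathcal{L}$, each of size $2$ or $3$, and three distinct elements $v_1,v_2,v_3\in[4]$ with $\{v_i,v_{i+1}\}\subseteq A_i$ for $i=1,2,3$ (where $v_4=v_1$).
   Context: The rank of a family $\mathcal{L}$ of subsets of $[k]$ is $r(\mathcal{L})=\min\{|D|: D\subseteq[k],\ \text{no } B\in\mathcal{L}\text{ with } D\subseteq B\}$. For an intersection-closed family $\mathcal{L}$ of proper subsets of $[k]$ of rank $k-1$, let $X=\{x\in[k]:[k]\setminus\{x\}\notin\mathcal{L}\}$; $\mathcal{L}$ is of type 1 if $|X|=1$ and of type 2 if $|X|\geq 2$. Here $k=4$. -}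

module Defs where

open import Data.Bool using (Bool; true; not)
open import Data.Nat using (ℕ; _<_; _≤_)
open import Data.Fin using (Fin)
open import Data.Fin.Subset using (Subset; ⊤; _-_; _∩_; _⊆_; _∈_; ∣_∣)
open import Data.Vec using (tabulate)
open import Data.Product using (Σ; _×_; ∃)
open import Relation.Nullary using (¬_)
open import Relation.Binary.PropositionalEquality using (_≡_; _≢_)

Family : Set
Family = Subset 4 → Bool

Mem : Family → Subset 4 → Set
Mem L A = L A ≡ true

IntersectionClosed : Family → Set
IntersectionClosed L = ∀ A B → Mem L A → Mem L B → Mem L (A ∩ B)

ProperMembers : Family → Set
ProperMembers L = ∀ A → Mem L A → A ≢ ⊤

Covered : Family → Subset 4 → Set
Covered L D = Σ (Subset 4) λ B → Mem L B × D ⊆ B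

HasRank : Family → ℕ → Set
HasRank L r =
  (Σ (Subset 4) λ D → ∣ D ∣ ≡ r × ¬ Covered L D)
  × (∀ D → ∣ D ∣ < r → Covered L D)

Xset : Family → Subset 4
Xset L = tabulate (λ x → not (L (⊤ - x)))

Type2 : Family → Set
Type2 L = 2 ≤ ∣ Xset L ∣

Size2or3 : Subset 4 → Set
Size2or3 A = (∣ A ∣ ≡ 2) ⊎' (∣ A ∣ ≡ 3)
  where open import Data.Sum renaming (_⊎_ to _⊎'_)

Minimal3Cycle : Family → Set
Minimal3Cycle L =
  Σ (Subset 4) λ A₁ → Σ (Subset 4) λ A₂ → Σ (Subset 4) λ A₃ →
  Mem L A₁ × Mem L A₂ × Mem L A₃ ×
  A₁ ≢ A₂ × A₂ ≢ A₃ × A₁ ≢ A₃ ×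
  Size2or3 A₁ × Size2or3 A₂ × Size2or3 A₃ ×
  Σ (Fin 4) λ v₁ → Σ (Fin 4) λ v₂ → Σ (Fin 4) λ v₃ →
  v₁ ≢ v₂ × v₂ ≢ v₃ × v₁ ≢ v₃ ×
  (v₁ ∈ A₁ × v₂ ∈ A₁) × (v₂ ∈ A₂ × v₃ ∈ A₂) × (v₃ ∈ A₃ × v₁ ∈ A₃)

-- Rank 3 provides a 3-set D = {x, y, z} lying in no member of L,
-- while every set of size at most 2 lies in some member.  For each vertex w of
-- D, the 2-set D - w is covered by a member of L; this gives three members
-- A₁ ⊇ {x, y}, A₂ ⊇ {y, z}, A₃ ⊇ {z, x}.  No two of them coincide, because a
-- member containing all of x, y, z would cover D.  Each Aᵢ contains two
-- distinct points and is a proper subset of [4], so it has size 2 or 3.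
module Submission where

open import Defs
open import Data.Nat using (ℕ; suc; _≤_; _<_; z≤n; s≤s)
open import Data.Nat.Properties using (≤-<-trans)
open import Data.Fin using (Fin)
open import Data.Fin.Patterns using (0F; 1F; 2F; 3F)
open import Data.Fin.Subset using (Subset; inside; outside; ⊤; ⁅_⁆; _∪_; _-_; _⊆_; _∈_; ∣_∣)
open import Data.Fin.Subset.Properties
  using (∣p∣≤n; ∣p∣≡n⇒p≡⊤; x∈p⇒∣p-x∣<∣p∣; x∈p∧x≢y⇒x∈p-y; x∈⁅x⁆; x∈⁅y⁆⇒x≡y; x∈p∪q⁺; x∈p∪q⁻)
open import Data.Vec using (_∷_; [])
open import Data.Product using (_,_)
open import Data.Sum using (_⊎_; inj₁; inj₂)
open import Data.Empty using (⊥; ⊥-elim)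
open import Relation.Nullary using (¬_)
open import Relation.Binary.PropositionalEquality using (_≡_; _≢_; refl; subst; sym)

-- A subset containing two distinct points has at least two elements:
-- removing them one after the other strictly decreases the size twice.
two≤∣p∣ : ∀ {n} {x y : Fin n} {p : Subset n} → x ∈ p → y ∈ p → x ≢ y → 2 ≤ ∣ p ∣
two≤∣p∣ {x = x} {y} {p} x∈p y∈p x≢y =
  ≤-<-trans (≤-<-trans z≤n (x∈p⇒∣p-x∣<∣p∣ {p = p - x} y∈p-x)) ∣p-x∣<∣p∣
  where
  y∈p-x : y ∈ p - x
  y∈p-x = x∈p∧x≢y⇒x∈p-y y∈p (λ y≡x → x≢y (sym y≡x))
  ∣p-x∣<∣p∣ : ∣ p - x ∣ < ∣ p ∣
  ∣p-x∣<∣p∣ = x∈p⇒∣p-x∣<∣p∣ {p = p} x∈p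

size2or3 : ∀ {x y : Fin 4} (B : Subset 4) → x ∈ B → y ∈ B → x ≢ y → B ≢ ⊤ → Size2or3 B
size2or3 B x∈B y∈B x≢y B≢⊤ = between (two≤∣p∣ x∈B y∈B x≢y) (∣p∣≤n B) (λ ∣B∣≡4 → B≢⊤ (∣p∣≡n⇒p≡⊤ ∣B∣≡4))
  where
  between : ∀ {k : ℕ} → 2 ≤ k → k ≤ 4 → k ≢ 4 → (k ≡ 2) ⊎ (k ≡ 3)
  between {0} () _ _
  between {1} (s≤s ()) _ _
  between {2} _ _ _ = inj₁ refl
  between {3} _ _ _ = inj₂ refl
  between {4} _ _ k≢4 = ⊥-elim (k≢4 refl)
  between {suc (suc (suc (suc (suc _))))} _ (s≤s (s≤s (s≤s (s≤s ())))) _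

triple : ∀ {n} → Fin n → Fin n → Fin n → Subset n
triple x y z = ⁅ x ⁆ ∪ ⁅ y ⁆ ∪ ⁅ z ⁆

∈-triple₁ : ∀ {n} (x y z : Fin n) → x ∈ triple x y z
∈-triple₁ x y z = x∈p∪q⁺ (inj₁ (x∈⁅x⁆ x))

∈-triple₂ : ∀ {n} (x y z : Fin n) → y ∈ triple x y z
∈-triple₂ x y z = x∈p∪q⁺ (inj₂ (x∈p∪q⁺ (inj₁ (x∈⁅x⁆ y))))

∈-triple₃ : ∀ {n} (x y z : Fin n) → z ∈ triple x y z
∈-triple₃ x y z = x∈p∪q⁺ (inj₂ (x∈p∪q⁺ (inj₂ (x∈⁅x⁆ z))))

triple-⊆ : ∀ {n} {x y z : Fin n} {B : Subset n} → x ∈ B → y ∈ B → z ∈ B → triple x y z ⊆ B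
triple-⊆ {x = x} {y} {z} x∈B y∈B z∈B w∈T with x∈p∪q⁻ ⁅ x ⁆ _ w∈T
... | inj₁ w∈⁅x⁆ = subst (_∈ _) (sym (x∈⁅y⁆⇒x≡y x w∈⁅x⁆)) x∈B
... | inj₂ w∈⁅y,z⁆ with x∈p∪q⁻ ⁅ y ⁆ _ w∈⁅y,z⁆
...   | inj₁ w∈⁅y⁆ = subst (_∈ _) (sym (x∈⁅y⁆⇒x≡y y w∈⁅y⁆)) y∈B
...   | inj₂ w∈⁅z⁆ = subst (_∈ _) (sym (x∈⁅y⁆⇒x≡y z w∈⁅z⁆)) z∈B

record Triangle (D : Subset 4) : Set where
  field
    x y z : Fin 4
    x≢y   : x ≢ y
    y≢z   : y ≢ z
    x≢z   : x ≢ z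
    shape : D ≡ triple x y z

triangle : (D : Subset 4) → ∣ D ∣ ≡ 3 → Triangle D
triangle (inside  ∷ inside  ∷ inside  ∷ outside ∷ []) _ = record { x = 0F ; y = 1F ; z = 2F ; x≢y = λ () ; y≢z = λ () ; x≢z = λ () ; shape = refl }
triangle (inside  ∷ inside  ∷ outside ∷ inside  ∷ []) _ = record { x = 0F ; y = 1F ; z = 3F ; x≢y = λ () ; y≢z = λ () ; x≢z = λ () ; shape = refl }
triangle (inside  ∷ outside ∷ inside  ∷ inside  ∷ []) _ = record { x = 0F ; y = 2F ; z = 3F ; x≢y = λ () ; y≢z = λ () ; x≢z = λ () ; shape = refl }
triangle (outside ∷ inside  ∷ inside  ∷ inside  ∷ []) _ = record { x = 1F ; y = 2F ; z = 3F ; x≢y = λ () ; y≢z = λ () ; x≢z = λ () ; shape = refl }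
triangle (inside  ∷ inside  ∷ inside  ∷ inside  ∷ []) ()
triangle (inside  ∷ inside  ∷ outside ∷ outside ∷ []) ()
triangle (inside  ∷ outside ∷ inside  ∷ outside ∷ []) ()
triangle (inside  ∷ outside ∷ outside ∷ inside  ∷ []) ()
triangle (inside  ∷ outside ∷ outside ∷ outside ∷ []) ()
triangle (outside ∷ inside  ∷ inside  ∷ outside ∷ []) ()
triangle (outside ∷ inside  ∷ outside ∷ inside  ∷ []) ()
triangle (outside ∷ inside  ∷ outside ∷ outside ∷ []) ()
triangle (outside ∷ outside ∷ inside  ∷ inside  ∷ []) ()
triangle (outside ∷ outside ∷ inside  ∷ outside ∷ []) ()
triangle (outside ∷ outside ∷ outside ∷ inside  ∷ []) ()
triangle (outside ∷ outside ∷ outside ∷ outside ∷ []) ()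

record Edge (L : Family) (u v : Fin 4) : Set where
  field
    set    : Subset 4
    member : Mem L set
    ∋u     : u ∈ set
    ∋v     : v ∈ set

cycleFromTriangle : (L : Family) → ProperMembers L → (D : Subset 4) → ∣ D ∣ ≡ 3 →
                    ¬ Covered L D → (∀ E → ∣ E ∣ < 3 → Covered L E) →
                    Triangle D → Minimal3Cycle L
cycleFromTriangle L proper D ∣D∣≡3 uncovered covers t =
  A₁ , A₂ , A₃ , member e₁ , member e₂ , member e₃ ,
  (λ A₁≡A₂ → notAll e₁ (∋u e₁) (∋v e₁) (subst (z ∈_) (sym A₁≡A₂) (∋v e₂))) ,
  (λ A₂≡A₃ → notAll e₂ (subst (x ∈_) (sym A₂≡A₃) (∋v e₃)) (∋u e₂) (∋v e₂)) ,
  (λ A₁≡A₃ → notAll e₁ (∋u e₁) (∋v e₁) (subst (z ∈_) (sym A₁≡A₃) (∋u e₃))) ,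
  size e₁ x≢y , size e₂ y≢z , size e₃ (λ z≡x → x≢z (sym z≡x)) ,
  x , y , z , x≢y , y≢z , x≢z ,
  (∋u e₁ , ∋v e₁) , (∋u e₂ , ∋v e₂) , (∋u e₃ , ∋v e₃)
  where
  open Triangle t
  open Edge

  x∈D : x ∈ D
  x∈D = subst (x ∈_) (sym shape) (∈-triple₁ x y z)
  y∈D : y ∈ D
  y∈D = subst (y ∈_) (sym shape) (∈-triple₂ x y z)
  z∈D : z ∈ D
  z∈D = subst (z ∈_) (sym shape) (∈-triple₃ x y z)

  notAll : ∀ {u v} (e : Edge L u v) → x ∈ set e → y ∈ set e → z ∈ set e → ⊥
  notAll e x∈A y∈A z∈A =
    uncovered (set e , member e , subst (_⊆ set e) (sym shape) (triple-⊆ x∈A y∈A z∈A))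

  -- The 2-set D - w is covered; its covering member contains the other two vertices.
  edgeOpposite : ∀ {u v w} → u ∈ D → v ∈ D → w ∈ D → u ≢ w → v ≢ w → Edge L u v
  edgeOpposite {w = w} u∈D v∈D w∈D u≢w v≢w with covers (D - w) (subst (∣ D - w ∣ <_) ∣D∣≡3 (x∈p⇒∣p-x∣<∣p∣ w∈D))
  ... | B , B∈L , D-w⊆B =
    record { set = B ; member = B∈L ; ∋u = D-w⊆B (x∈p∧x≢y⇒x∈p-y u∈D u≢w) ; ∋v = D-w⊆B (x∈p∧x≢y⇒x∈p-y v∈D v≢w) }

  e₁ : Edge L x y
  e₁ = edgeOpposite x∈D y∈D z∈D x≢z y≢z
  e₂ : Edge L y z
  e₂ = edgeOpposite y∈D z∈D x∈D (λ y≡x → x≢y (sym y≡x)) (λ z≡x → x≢z (sym z≡x))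
  e₃ : Edge L z x
  e₃ = edgeOpposite z∈D x∈D y∈D (λ z≡y → y≢z (sym z≡y)) x≢y

  A₁ A₂ A₃ : Subset 4
  A₁ = set e₁
  A₂ = set e₂
  A₃ = set e₃

  size : ∀ {u v} (e : Edge L u v) → u ≢ v → Size2or3 (set e)
  size e u≢v = size2or3 (set e) (∋u e) (∋v e) u≢v (proper (set e) (member e))

proposition8p5 : (L : Family) → IntersectionClosed L → ProperMembers L →
                 HasRank L 3 → Type2 L → Minimal3Cycle L
proposition8p5 L _ proper ((D , ∣D∣≡3 , uncovered) , covers) _ =
  cycleFromTriangle L proper D ∣D∣≡3 uncovered covers (triangle D ∣D∣≡3)
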